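{- If $G$ is a minimally $2$-connected graph of order $n\geq 4$, then $mvd(G)\leq \left\lfloor \frac{n}{2}\right\rfloor$.
   Context: All graphs are finite, simple, undirected and connected. A graph is minimally $2$-connected if it is $2$-connected but $G-e$ is not $2$-connected for every edge $e$. For a vertex-colored graph and two nonadjacent vertices $x,y$, an $x$-$y$ vertex cut is a set $S\subseteq V(G)\setminus\{x,y\}$ such that $x$ and $y$ lie in different components of $G-S$; it is monochromatic if all its vertices have the same color. A vertex-coloring is an MVD-coloring if every pair of nonadjacent vertices has a monochromatic vertex cut separating them. $mvd(G)$ is the maximum number of colors used by an MVD-coloring of $G$. -}

module Defs where

open import Data.Nat using (ℕ; _≤_; _/_)
open import Data.Nat.Properties using (_≟_)
open import Data.Fin using (Fin)
open import Data.Fin.Subset using (Subset; _∈_; _∉_; ⁅_⁆; ⊥)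
open import Data.List using (length; map; deduplicate)
open import Data.List.Base using ()
open import Data.Fin using () renaming (_≟_ to _≟ᶠ_)
open import Data.Vec using (allFin)
open import Data.Vec using (toList)
open import Data.Product using (Σ; _×_; ∃)
open import Relation.Nullary using (¬_)
open import Relation.Binary.PropositionalEquality using (_≡_; _≢_)

record Graph (n : ℕ) : Set₁ where
  field
    Adj   : Fin n → Fin n → Set
    sym   : ∀ {x y} → Adj x y → Adj y x
    irref : ∀ {x} → ¬ Adj x x
open Graph public

-- Reach E S x y : there is a walk from x to y along E-edges using only
-- vertices outside S (i.e. x and y are in the same component of (V,E) - S).
data Reach {n : ℕ} (E : Fin n → Fin n → Set) (S : Subset n) (x : Fin n) : Fin n → Set where
  here : x ∉ S → Reach E S x x
  step : ∀ {y z} → Reach E S x y → E y z → z ∉ S → Reach E S x z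

ConnectedMinus : {n : ℕ} → (Fin n → Fin n → Set) → Subset n → Set
ConnectedMinus E S = ∀ x y → x ∉ S → y ∉ S → Reach E S x y

TwoConnectedRel : (n : ℕ) → (Fin n → Fin n → Set) → Set
TwoConnectedRel n E = (3 ≤ n) × ConnectedMinus E ⊥ × (∀ v → ConnectedMinus E ⁅ v ⁆)

TwoConnected : {n : ℕ} → Graph n → Set
TwoConnected {n} G = TwoConnectedRel n (Adj G)

DeleteEdge : {n : ℕ} → Graph n → Fin n → Fin n → (Fin n → Fin n → Set)
DeleteEdge G u v x y = Adj G x y × ¬ (x ≡ u × y ≡ v) × ¬ (x ≡ v × y ≡ u)

MinimallyTwoConnected : {n : ℕ} → Graph n → Set
MinimallyTwoConnected {n} G =
  TwoConnected G × (∀ u v → Adj G u v → ¬ TwoConnectedRel n (DeleteEdge G u v))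

Coloring : ℕ → Set
Coloring n = Fin n → ℕ

IsVertexCut : {n : ℕ} → Graph n → Fin n → Fin n → Subset n → Set
IsVertexCut G x y S = x ∉ S × y ∉ S × ¬ Reach (Adj G) S x y

Monochromatic : {n : ℕ} → Coloring n → Subset n → Set
Monochromatic c S = ∃ λ a → ∀ v → v ∈ S → c v ≡ a

IsMVDColoring : {n : ℕ} → Graph n → Coloring n → Set
IsMVDColoring G c = ∀ x y → x ≢ y → ¬ Adj G x y →
  ∃ λ S → IsVertexCut G x y S × Monochromatic c S

numColors : {n : ℕ} → Coloring n → ℕ
numColors {n} c = length (deduplicate _≟_ (map c (toList (allFin n))))

-- mvd(G) ≤ k : every MVD-coloring uses at most k colors.
MvdAtMost : {n : ℕ} → Graph n → ℕ → Set
MvdAtMost G k = ∀ c → IsMVDColoring G c → numColors c ≤ k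

-- Every vertex v of a minimally 2-connected graph on at least four vertices has two
-- nonadjacent neighbours u, w.  Otherwise the neighbourhood of v is a clique, and one
-- shows that u and w stay joined in (G - uw) - v (through a third neighbour of v, or,
-- when v has degree two, around v through a fourth vertex), so G - uw is still
-- 2-connected.  In an MVD-coloring the monochromatic u-w cut must contain v (because of
-- the walk u v w) and some other vertex (because G - v is connected), so every colour
-- class has at least two vertices and at most n / 2 colours are used.
module Submission where

open import Defs
open import Data.Nat using (ℕ; _≤_; _<_; _+_; _*_; _/_; z≤n; s≤s)
open import Data.Nat.Properties
  using (≤-reflexive; ≤-trans; <⇒≱; *-comm; +-identityʳ; module ≤-Reasoning)
  renaming (_≟_ to _≟ℕ_)
open import Data.Nat.DivMod using (m*n/n≡m; /-monoˡ-≤)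
open import Data.Fin using (Fin; zero; suc; splitAt) renaming (_≟_ to _≟ᶠ_)
open import Data.Fin.Properties using (any?; injective⇒≤; +↔⊎)
open import Data.Fin.Subset using (_∈_; _∉_; ⁅_⁆)
open import Data.Fin.Subset.Properties using (_∈?_; ∉⊥; x≢y⇒x∉⁅y⁆; x∉⁅y⁆⇒x≢y)
open import Data.List using (List; []; _∷_; length; map; deduplicate; lookup)
import Data.List.Relation.Unary.Any as Any
open Any using (here; there)
import Data.List.Relation.Unary.All as All
open import Data.List.Relation.Unary.AllPairs using (_∷_)
open import Data.List.Relation.Unary.Unique.Propositional using (Unique)
open import Data.List.Relation.Unary.Unique.DecPropositional.Properties using (deduplicate-!)
import Data.List.Membership.Propositional as Listₚ
open import Data.List.Membership.Setoid.Properties using (index-injective)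
open import Data.List.Membership.Propositional.Properties using (∈-map⁻; ∈-deduplicate⁻; ∈-lookup)
open import Data.Vec using (allFin; toList)
open import Data.Product using (∃; ∃₂; _×_; _,_; proj₁; proj₂; swap)
open import Data.Sum using (_⊎_; inj₁; inj₂; reduce)
open import Data.Empty using (⊥-elim)
open import Function using (_∘_)
open import Function.Bundles using (Injection)
open import Function.Properties.Inverse using (↔⇒↣)
open import Relation.Nullary using (¬_; yes; no; ¬?; _×-dec_; contradiction)
open import Relation.Nullary.Decidable using (decidable-stable)
open import Relation.Binary.PropositionalEquality
  using (_≡_; _≢_; refl; trans; cong; setoid)
  renaming (sym to ≡-sym)

module _ {n : ℕ} {E : Fin n → Fin n → Set} where

  Reach-target∉ : ∀ {S x y} → Reach E S x y → y ∉ S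
  Reach-target∉ (here y∉S)     = y∉S
  Reach-target∉ (step _ _ y∉S) = y∉S

  Reach-trans : ∀ {S x y z} → Reach E S x y → Reach E S y z → Reach E S x z
  Reach-trans r (here _)       = r
  Reach-trans r (step r′ e z∉S) = step (Reach-trans r r′) e z∉S

  Reach-sym : (∀ {a b} → E a b → E b a) → ∀ {S x y} → Reach E S x y → Reach E S y x
  Reach-sym E-sym (here x∉S)      = here x∉S
  Reach-sym E-sym (step r e z∉S) =
    Reach-trans (step (here z∉S) (E-sym e) (Reach-target∉ r)) (Reach-sym E-sym r)

  Reach-antitone : ∀ {S T x y} → (∀ z → z ∉ T → z ∉ S) → Reach E T x y → Reach E S x y
  Reach-antitone T⊇S (here x∉T)      = here (T⊇S _ x∉T)
  Reach-antitone T⊇S (step r e z∉T) = step (Reach-antitone T⊇S r) e (T⊇S _ z∉T)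

  Reach-map : ∀ {F : Fin n → Fin n → Set} {S x y} →
              (∀ {a b} → a ∉ S → b ∉ S → E a b → F a b) → Reach E S x y → Reach F S x y
  Reach-map E⊆F (here x∉S)      = here x∉S
  Reach-map E⊆F (step r e z∉S) = step (Reach-map E⊆F r) (E⊆F (Reach-target∉ r) z∉S e) z∉S

  -- The step by which a walk from v leaves v for the last time.
  Reach⇒neighbour : ∀ {S v x} → Reach E S v x → x ≢ v → ∃ λ z → E v z × z ∉ S
  Reach⇒neighbour (here _) x≢v = contradiction refl x≢v
  Reach⇒neighbour {v = v} (step {y} {z} r e z∉S) z≢v with y ≟ᶠ v
  ... | yes refl = z , e , z∉S
  ... | no y≢v   = Reach⇒neighbour r y≢v

  -- Every time the walk leaves v it moves to a, so it can be restarted there.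
  Reach-bypass : ∀ {S a v z} → a ≢ v → (∀ t → E v t → t ∉ S → t ≡ a) →
                 Reach E S a z → z ≢ v → Reach E ⁅ v ⁆ a z
  Reach-bypass a≢v onlyA (here _) _ = here (x≢y⇒x∉⁅y⁆ a≢v)
  Reach-bypass {v = v} a≢v onlyA (step {y} r e z∉S) z≢v with y ≟ᶠ v
  ... | no y≢v = step (Reach-bypass a≢v onlyA r y≢v) e (x≢y⇒x∉⁅y⁆ z≢v)
  ... | yes refl with onlyA _ e z∉S
  ...   | refl = here (x≢y⇒x∉⁅y⁆ a≢v)

∃-∉ : ∀ {n} (xs : List (Fin n)) → length xs < n → ∃ λ p → p Listₚ.∉ xs
∃-∉ {n} xs |xs|<n with any? (λ p → ¬? (Any.any? (p ≟ᶠ_) xs))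
... | yes p∉xs = p∉xs
... | no ¬p∉xs = contradiction (injective⇒≤ position-injective) (<⇒≱ |xs|<n)
  where
  ∈xs : ∀ p → p Listₚ.∈ xs
  ∈xs p = decidable-stable (Any.any? (p ≟ᶠ_) xs) (¬p∉xs ∘ (p ,_))
  position-injective : ∀ {p q} → Any.index (∈xs p) ≡ Any.index (∈xs q) → p ≡ q
  position-injective = index-injective (setoid (Fin n)) (∈xs _) (∈xs _)

lookup-injective : ∀ {A : Set} {xs : List A} → Unique xs →
                   ∀ i j → lookup xs i ≡ lookup xs j → i ≡ j
lookup-injective (_ ∷ _)   zero    zero    _  = refl
lookup-injective (x∉ ∷ _)  zero    (suc j) eq = contradiction eq (All.lookup x∉ (∈-lookup j))
lookup-injective (x∉ ∷ _)  (suc i) zero    eq = contradiction (≡-sym eq) (All.lookup x∉ (∈-lookup i))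
lookup-injective (_ ∷ xs!) (suc i) (suc j) eq = cong suc (lookup-injective xs! i j eq)

m+m≤n⇒m≤n/2 : ∀ {m n} → m + m ≤ n → m ≤ n / 2
m+m≤n⇒m≤n/2 {m} {n} m+m≤n = begin
  m         ≡⟨ ≡-sym (m*n/n≡m m 2) ⟩
  m * 2 / 2 ≤⟨ /-monoˡ-≤ 2 (≤-trans (≤-reflexive m*2≡m+m) m+m≤n) ⟩
  n / 2     ∎
  where
  open ≤-Reasoning
  m*2≡m+m : m * 2 ≡ m + m
  m*2≡m+m = trans (*-comm m 2) (cong (m +_) (+-identityʳ m))

twoPreimages⇒2|xs|≤n : ∀ {A : Set} {n} (c : Fin n → A) (xs : List A) → Unique xs →
  (∀ i → ∃₂ λ v w → v ≢ w × c v ≡ lookup xs i × c w ≡ lookup xs i) →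
  length xs + length xs ≤ n
twoPreimages⇒2|xs|≤n c xs xs! fibre =
  injective⇒≤ (splitAt-injective ∘ pick-injective)
  where
  pick : Fin (length xs) ⊎ Fin (length xs) → Fin _
  pick (inj₁ i) = proj₁ (fibre i)
  pick (inj₂ i) = proj₁ (proj₂ (fibre i))
  colour-pick : ∀ s → c (pick s) ≡ lookup xs (reduce s)
  colour-pick (inj₁ i) = proj₁ (proj₂ (proj₂ (proj₂ (fibre i))))
  colour-pick (inj₂ i) = proj₂ (proj₂ (proj₂ (proj₂ (fibre i))))
  distinct : ∀ i → pick (inj₁ i) ≢ pick (inj₂ i)
  distinct i = proj₁ (proj₂ (proj₂ (fibre i)))
  sameIndex : ∀ s t → pick s ≡ pick t → reduce s ≡ reduce t
  sameIndex s t eq = lookup-injective xs! (reduce s) (reduce t)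
    (trans (≡-sym (colour-pick s)) (trans (cong c eq) (colour-pick t)))
  pick-injective : ∀ {s t} → pick s ≡ pick t → s ≡ t
  pick-injective {inj₁ i} {inj₁ j} eq = cong inj₁ (sameIndex (inj₁ i) (inj₁ j) eq)
  pick-injective {inj₂ i} {inj₂ j} eq = cong inj₂ (sameIndex (inj₂ i) (inj₂ j) eq)
  pick-injective {inj₁ i} {inj₂ j} eq with sameIndex (inj₁ i) (inj₂ j) eq
  ... | refl = contradiction eq (distinct i)
  pick-injective {inj₂ i} {inj₁ j} eq with sameIndex (inj₂ i) (inj₁ j) eq
  ... | refl = contradiction (≡-sym eq) (distinct i)
  splitAt-injective : ∀ {k l : Fin (length xs + length xs)} →
                      splitAt (length xs) k ≡ splitAt (length xs) l → k ≡ l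
  splitAt-injective = Injection.injective (↔⇒↣ +↔⊎)

ColourRepeated : ∀ {n} → Coloring n → Fin n → Set
ColourRepeated c v = ∃ λ w → w ≢ v × c w ≡ c v

numColors≤n/2 : ∀ {n} (c : Coloring n) → (∀ v → ColourRepeated c v) → numColors c ≤ n / 2
numColors≤n/2 {n} c repeated =
  m+m≤n⇒m≤n/2 (twoPreimages⇒2|xs|≤n c colours (deduplicate-! _≟ℕ_ allColours) fibre)
  where
  allColours colours : List ℕ
  allColours = map c (toList (allFin n))
  colours = deduplicate _≟ℕ_ allColours
  fibre : ∀ i → ∃₂ λ v w → v ≢ w × c v ≡ lookup colours i × c w ≡ lookup colours i
  fibre i with ∈-map⁻ c (∈-deduplicate⁻ _≟ℕ_ allColours (∈-lookup {xs = colours} i))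
  ... | v , _ , i↦cv with repeated v
  ...   | w , w≢v , cw≡cv = v , w , w≢v ∘ ≡-sym , ≡-sym i↦cv , trans cw≡cv (≡-sym i↦cv)

module _ {n : ℕ} (G : Graph n) where

  NonadjacentNeighbours : Fin n → Set
  NonadjacentNeighbours v = ∃₂ λ u w → Adj G v u × Adj G v w × u ≢ w × ¬ Adj G u w

  Adj⇒≢ : ∀ {x y} → Adj G x y → x ≢ y
  Adj⇒≢ xy refl = irref G xy

  DeleteEdge-sym : ∀ {u w a b} → DeleteEdge G u w a b → DeleteEdge G u w b a
  DeleteEdge-sym (ab , ¬uw , ¬wu) = sym G ab , ¬wu ∘ swap , ¬uw ∘ swap

  Adj⇒DeleteEdge : ∀ {u w a b x} → Adj G a b → a ≢ x → b ≢ x → x ≡ u ⊎ x ≡ w →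
                   DeleteEdge G u w a b
  Adj⇒DeleteEdge ab a≢x b≢x (inj₁ refl) = ab , a≢x ∘ proj₁ , b≢x ∘ proj₂
  Adj⇒DeleteEdge ab a≢x b≢x (inj₂ refl) = ab , b≢x ∘ proj₂ , a≢x ∘ proj₁

  Reach-DeleteEdge : ∀ {u w x a b} → x ≡ u ⊎ x ≡ w →
                     Reach (Adj G) ⁅ x ⁆ a b → Reach (DeleteEdge G u w) ⁅ x ⁆ a b
  Reach-DeleteEdge x∈uw = Reach-map λ a∉ b∉ ab →
    Adj⇒DeleteEdge ab (x∉⁅y⁆⇒x≢y a∉) (x∉⁅y⁆⇒x≢y b∉) x∈uw

  Reach-reroute : ∀ {u w S a b} → (u ∉ S → w ∉ S → Reach (DeleteEdge G u w) S u w) →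
                  Reach (Adj G) S a b → Reach (DeleteEdge G u w) S a b
  Reach-reroute detour (here a∉S) = here a∉S
  Reach-reroute {u} {w} detour (step {y} {z} r yz z∉S)
    with (y ≟ᶠ u) ×-dec (z ≟ᶠ w) | (y ≟ᶠ w) ×-dec (z ≟ᶠ u)
  ... | yes (refl , refl) | _ = Reach-trans (Reach-reroute detour r) (detour (Reach-target∉ r) z∉S)
  ... | no _ | yes (refl , refl) =
    Reach-trans (Reach-reroute detour r) (Reach-sym DeleteEdge-sym (detour z∉S (Reach-target∉ r)))
  ... | no ¬uw | no ¬wu = step (Reach-reroute detour r) (yz , ¬uw , ¬wu) z∉S

  ∃-twoNeighbours : TwoConnected G → ∀ v → ∃₂ λ u w → Adj G v u × Adj G v w × u ≢ w
  ∃-twoNeighbours (3≤n , connected , connected₁) v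
    with ∃-∉ (v ∷ []) (≤-trans (s≤s (s≤s z≤n)) 3≤n)
  ... | x , x∉ with Reach⇒neighbour (connected v x ∉⊥ ∉⊥) (x∉ ∘ here)
  ...   | u , vu , _ with ∃-∉ (u ∷ v ∷ []) 3≤n
  ...     | y , y∉ with Reach⇒neighbour
                          (connected₁ u v y (x≢y⇒x∉⁅y⁆ (Adj⇒≢ vu)) (x≢y⇒x∉⁅y⁆ (y∉ ∘ here)))
                          (y∉ ∘ there ∘ here)
  ...       | w , vw , w∉⁅u⁆ = u , w , vu , vw , x∉⁅y⁆⇒x≢y w∉⁅u⁆ ∘ ≡-sym

  DeleteEdge-twoConnected : ∀ {u v w} → TwoConnected G → Adj G u w → Adj G v u → Adj G v w →
    Reach (DeleteEdge G u w) ⁅ v ⁆ u w → TwoConnectedRel n (DeleteEdge G u w)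
  DeleteEdge-twoConnected {u} {v} {w} (3≤n , connected , connected₁) uw vu vw detour =
    3≤n ,
    (λ x y x∉ y∉ → Reach-reroute (throughV ∉⊥) (connected x y x∉ y∉)) ,
    connected₁′
    where
    u≢w : u ≢ w
    u≢w = Adj⇒≢ uw
    throughV : ∀ {S} → v ∉ S → u ∉ S → w ∉ S → Reach (DeleteEdge G u w) S u w
    throughV v∉S u∉S w∉S =
      step (step (here u∉S) (Adj⇒DeleteEdge (sym G vu) u≢w (Adj⇒≢ vw) (inj₂ refl)) v∉S)
           (Adj⇒DeleteEdge vw (Adj⇒≢ vu) (u≢w ∘ ≡-sym) (inj₁ refl)) w∉S
    connected₁′ : ∀ s → ConnectedMinus (DeleteEdge G u w) ⁅ s ⁆
    connected₁′ s x y x∉ y∉ with s ≟ᶠ v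
    ... | yes refl = Reach-reroute (λ _ _ → detour) (connected₁ s x y x∉ y∉)
    ... | no s≢v   =
      Reach-reroute (throughV (x≢y⇒x∉⁅y⁆ (s≢v ∘ ≡-sym))) (connected₁ s x y x∉ y∉)

  minimal⇒¬detour : ∀ {u v w} → MinimallyTwoConnected G → Adj G u w → Adj G v u → Adj G v w →
                    ¬ Reach (DeleteEdge G u w) ⁅ v ⁆ u w
  minimal⇒¬detour (tc , minimal) uw vu vw detour =
    minimal _ _ uw (DeleteEdge-twoConnected tc uw vu vw detour)

  -- Walk to a fourth vertex q from u in G - w and from w in G - u; such walks can only
  -- re-enter v from their start, so Reach-bypass removes v from them.
  degreeTwo⇒detour : ∀ {u v w} → 4 ≤ n → TwoConnected G → Adj G v u → Adj G v w → u ≢ w →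
    (∀ z → Adj G v z → z ≡ u ⊎ z ≡ w) → Reach (DeleteEdge G u w) ⁅ v ⁆ u w
  degreeTwo⇒detour {u} {v} {w} 4≤n (_ , _ , connected₁) vu vw u≢w N[v]⊆uw
    with ∃-∉ (u ∷ v ∷ w ∷ []) 4≤n
  ... | q , q∉ = Reach-trans (towardsQ (inj₂ refl) u≢w vu)
                             (Reach-sym DeleteEdge-sym (towardsQ (inj₁ refl) (u≢w ∘ ≡-sym) vw))
    where
    q≢v : q ≢ v
    q≢v = q∉ ∘ there ∘ here
    q≢u⊎w : ∀ {b} → b ≡ u ⊎ b ≡ w → q ≢ b
    q≢u⊎w (inj₁ refl) = q∉ ∘ here
    q≢u⊎w (inj₂ refl) = q∉ ∘ there ∘ there ∘ here
    otherNeighbour : ∀ {a b} → b ≡ u ⊎ b ≡ w → a ≢ b → Adj G v a →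
                     ∀ t → Adj G v t → t ≢ b → t ≡ a
    otherNeighbour {a} b∈uw a≢b va t vt t≢b with N[v]⊆uw t vt | N[v]⊆uw a va | b∈uw
    ... | inj₁ refl | inj₁ refl | _         = refl
    ... | inj₂ refl | inj₂ refl | _         = refl
    ... | inj₁ refl | inj₂ refl | inj₁ refl = contradiction refl t≢b
    ... | inj₁ refl | inj₂ refl | inj₂ refl = contradiction refl a≢b
    ... | inj₂ refl | inj₁ refl | inj₁ refl = contradiction refl a≢b
    ... | inj₂ refl | inj₁ refl | inj₂ refl = contradiction refl t≢b
    towardsQ : ∀ {a b} → b ≡ u ⊎ b ≡ w → a ≢ b → Adj G v a → Reach (DeleteEdge G u w) ⁅ v ⁆ a q
    towardsQ b∈uw a≢b va =
      Reach-bypass (Adj⇒≢ va ∘ ≡-sym)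
        (λ t vt t∉⁅b⁆ → otherNeighbour b∈uw a≢b va t (proj₁ vt) (x∉⁅y⁆⇒x≢y t∉⁅b⁆))
        (Reach-DeleteEdge b∈uw
          (connected₁ _ _ q (x≢y⇒x∉⁅y⁆ a≢b) (x≢y⇒x∉⁅y⁆ (q≢u⊎w b∈uw))))
        q≢v

  minimal⇒nonadjacentNeighbours : 4 ≤ n → MinimallyTwoConnected G →
                                  ∀ v → ¬ ¬ NonadjacentNeighbours v
  minimal⇒nonadjacentNeighbours 4≤n mtc@(tc , _) v ¬nonadjacent
    with ∃-twoNeighbours tc v
  ... | u , w , vu , vw , u≢w = adjacent vu vw u≢w λ uw →
    minimal⇒¬detour mtc uw vu vw (degreeTwo⇒detour 4≤n tc vu vw u≢w (N[v]⊆uw uw))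
    where
    adjacent : ∀ {a b} → Adj G v a → Adj G v b → a ≢ b → ¬ ¬ Adj G a b
    adjacent va vb a≢b ¬ab = ¬nonadjacent (_ , _ , va , vb , a≢b , ¬ab)
    -- A third neighbour z would be adjacent to both u and w, giving the detour u z w.
    N[v]⊆uw : Adj G u w → ∀ z → Adj G v z → z ≡ u ⊎ z ≡ w
    N[v]⊆uw uw z vz with z ≟ᶠ u | z ≟ᶠ w
    ... | yes z≡u | _       = inj₁ z≡u
    ... | no _    | yes z≡w = inj₂ z≡w
    ... | no z≢u  | no z≢w  =
      ⊥-elim (adjacent vu vz (z≢u ∘ ≡-sym) λ uz → adjacent vz vw z≢w λ zw →
        minimal⇒¬detour mtc uw vu vw
          (step (step (here (x≢y⇒x∉⁅y⁆ (Adj⇒≢ vu ∘ ≡-sym)))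
                      (Adj⇒DeleteEdge uz u≢w z≢w (inj₂ refl))
                      (x≢y⇒x∉⁅y⁆ (Adj⇒≢ vz ∘ ≡-sym)))
                (Adj⇒DeleteEdge zw z≢u (u≢w ∘ ≡-sym) (inj₁ refl))
                (x≢y⇒x∉⁅y⁆ (Adj⇒≢ vw ∘ ≡-sym))))

  mvd⇒colourRepeated : ∀ {c v} → TwoConnected G → IsMVDColoring G c →
                       NonadjacentNeighbours v → ColourRepeated c v
  mvd⇒colourRepeated {c} {v} (_ , _ , connected₁) mvd (u , w , vu , vw , u≢w , ¬uw)
    with mvd u w u≢w ¬uw
  ... | S , (u∉S , w∉S , ¬reach) , _ , mono with v ∈? S
  ...   | no v∉S = contradiction (step (step (here u∉S) (sym G vu) v∉S) vw w∉S) ¬reach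
  ...   | yes v∈S with any? (λ z → (z ∈? S) ×-dec ¬? (z ≟ᶠ v))
  ...     | yes (z , z∈S , z≢v) = z , z≢v , trans (mono z z∈S) (≡-sym (mono v v∈S))
  ...     | no ¬other = contradiction
    (Reach-antitone S⊆⁅v⁆
      (connected₁ v u w (x≢y⇒x∉⁅y⁆ (Adj⇒≢ vu ∘ ≡-sym)) (x≢y⇒x∉⁅y⁆ (Adj⇒≢ vw ∘ ≡-sym))))
    ¬reach
    where
    S⊆⁅v⁆ : ∀ z → z ∉ ⁅ v ⁆ → z ∉ S
    S⊆⁅v⁆ z z∉⁅v⁆ z∈S = ¬other (z , z∈S , x∉⁅y⁆⇒x≢y z∉⁅v⁆)

theorem1p2 : (n : ℕ) → 4 ≤ n → (G : Graph n) → MinimallyTwoConnected G → MvdAtMost G (n / 2)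
theorem1p2 n 4≤n G mtc@(tc , _) c mvd = numColors≤n/2 c repeated
  where
  repeated : ∀ v → ColourRepeated c v
  repeated v = decidable-stable
    (any? λ w → ¬? (w ≟ᶠ v) ×-dec (c w ≟ℕ c v))
    λ ¬repeated → minimal⇒nonadjacentNeighbours G 4≤n mtc v
                    (¬repeated ∘ mvd⇒colourRepeated G tc mvd)
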